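{- The class of all (claw, odd-hole)-free graphs is cop-unbounded: for every integer $k$ there is a (claw, odd-hole)-free graph $G$ with cop number $c(G)>k$.
   Context: A claw is the star $K_{1,3}$; a hole is an induced cycle of length at least $4$; an odd hole is a hole of odd length. A graph is $H$-free if it has no induced subgraph isomorphic to $H$. Game of cops and robber on a connected graph: in the first round the cops choose their starting vertices, then the robber chooses his; afterwards, in each round, first every cop either stays or moves to an adjacent vertex, then the robber either stays or moves to an adjacent vertex. The cops win if some cop occupies the robber's vertex. The cop number $c(G)$ of a connected graph is the minimum number of cops having a winning strategy; for a disconnected graph it is the maximum of the cop numbers of its components. A class of graphs is cop-bounded if there is a constant $k$ with $c(G)\le k$ for all $G$ in the class, and cop-unbounded otherwise. -}

module Defs where

open import Data.Nat using (ℕ; zero; suc; _+_; _*_; _≤_; _%_; _≡ᵇ_)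
open import Data.Fin using (Fin; toℕ)
open import Data.Bool using (Bool; true; false; _∨_)
open import Data.Product using (Σ; ∃; _×_; _,_)
open import Data.Sum using (_⊎_)
open import Relation.Binary.PropositionalEquality using (_≡_; _≢_)
open import Relation.Nullary using (¬_)
open import Function.Definitions using (Injective)

record Graph : Set where
  field
    n      : ℕ
    adj    : Fin n → Fin n → Bool
    sym    : ∀ u v → adj u v ≡ adj v u
    irrefl : ∀ v → adj v v ≡ false

open Graph public

V : Graph → Set
V G = Fin (n G)

Adj : (G : Graph) → V G → V G → Set
Adj G u v = adj G u v ≡ true

NonAdj : (G : Graph) → V G → V G → Set
NonAdj G u v = adj G u v ≡ false

data Reach (G : Graph) : V G → V G → Set where
  here : ∀ {u} → Reach G u u
  step : ∀ {u v w} → Adj G u v → Reach G v w → Reach G u w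

Connected : Graph → Set
Connected G = (1 ≤ n G) × (∀ u v → Reach G u v)

HasClaw : Graph → Set
HasClaw G = Σ (V G) λ c → Σ (V G) λ a → Σ (V G) λ b → Σ (V G) λ d →
  Adj G c a × Adj G c b × Adj G c d ×
  a ≢ b × a ≢ d × b ≢ d ×
  NonAdj G a b × NonAdj G a d × NonAdj G b d

ClawFree : Graph → Set
ClawFree G = ¬ HasClaw G

cycAdj : (m : ℕ) → Fin (suc m) → Fin (suc m) → Bool
cycAdj m i j = (toℕ j ≡ᵇ (suc (toℕ i) % suc m)) ∨ (toℕ i ≡ᵇ (suc (toℕ j) % suc m))

-- Induced cycle of length l = suc m, i.e. an injective map f from the cycle
-- C_l whose image induces exactly the cycle edges.
InducedCycle : (G : Graph) (m : ℕ) → Set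
InducedCycle G m = Σ (Fin (suc m) → V G) λ f →
  Injective _≡_ _≡_ f × (∀ i j → adj G (f i) (f j) ≡ cycAdj m i j)

HasOddHole : Graph → Set
HasOddHole G = Σ ℕ λ m → (4 ≤ suc m) × (∃ λ t → suc m ≡ 1 + 2 * t) × InducedCycle G m

OddHoleFree : Graph → Set
OddHoleFree G = ¬ HasOddHole G

Config : Graph → ℕ → Set
Config G k = Fin k → V G

Captured : (G : Graph) {k : ℕ} → Config G k → V G → Set
Captured G cs r = ∃ λ i → cs i ≡ r

StepOrStay : (G : Graph) → V G → V G → Set
StepOrStay G u v = (u ≡ v) ⊎ Adj G u v

CopMove : (G : Graph) {k : ℕ} → Config G k → Config G k → Set
CopMove G cs cs' = ∀ i → StepOrStay G (cs i) (cs' i)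

-- CopsForce G k cs r : at a position where cops (at cs) are about to move
-- and the robber is at r, the cops can force a capture in finitely many rounds.
data CopsForce (G : Graph) (k : ℕ) : Config G k → V G → Set where
  round : ∀ {cs r} (cs' : Config G k) → CopMove G cs cs' →
    (Captured G cs' r ⊎
      (∀ r' → StepOrStay G r r' → Captured G cs' r' ⊎ CopsForce G k cs' r')) →
    CopsForce G k cs r

CopsWin : Graph → ℕ → Set
CopsWin G k = Σ (Config G k) λ cs → ∀ r → Captured G cs r ⊎ CopsForce G k cs r

CopNumberGreaterThan : Graph → ℕ → Set
CopNumberGreaterThan G k = ¬ CopsWin G k

{-# OPTIONS --safe #-}
-- The witness is the line graph of the bipartite graph H_D whose sides are two copies of {0,1}^D,
-- a vector on one side being joined to the vectors at Hamming distance at most one on the other.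
-- Line graphs are claw-free, and along an induced cycle in the line graph of a bipartite graph the
-- end shared by consecutive edges alternates between the two sides, so such cycles are even.
-- Against k cops the robber keeps his edge incident to a vertex u of H whose closed neighbourhood
-- contains no end of a cop edge. After the cops move u is still not such an end, and a cop end other
-- than u near the neighbour of u in direction i differs from u in coordinate i and in at most one
-- other; so each of the 2k cop ends rules out at most two directions, and once D > 4k the robber can
-- move to an edge uw where no cop end is near w.

module Submission where

open import Defs
open import Data.Bool as Bool using (Bool; true; false; not; _∨_; if_then_else_)
open import Data.Bool.Properties using (not-¬; not-involutive)
open import Data.Empty using (⊥; ⊥-elim)
open import Data.Fin as Fin using (Fin; zero; suc; toℕ; fromℕ<; combine; remQuot; finToFun; funToFin)
open import Data.Fin.Properties using (toℕ<n; toℕ-fromℕ<; toℕ-injective; remQuot-combine; finToFun-funToFin)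
open import Data.List using (List; []; _∷_; map; length; filter)
open import Data.List.Membership.Propositional using (_∈_)
open import Data.List.Membership.Propositional.Properties using (∈-map⁺; ∈-filter⁺)
open import Data.List.Properties using (map-∘; length-map; length-filter)
open import Data.List.Relation.Unary.All as All using (All; []; _∷_)
open import Data.List.Relation.Unary.All.Properties using (¬All⇒Any¬; all-filter; map⁺; map⁻)
open import Data.List.Relation.Unary.Any as Any using (Any; here; there)
open import Data.Nat as ℕ using (ℕ; zero; suc; _+_; _*_; _^_; _%_; _/_; _<_; _≤_; _≤?_; z≤n; s≤s; NonZero)
open import Data.Nat.DivMod using (m%n<n; m%n%n≡m%n; %-distribˡ-+; [m+n]%n≡m%n; m≡m%n+[m/n]*n)
open import Data.Nat.ListAction using (sum)
open import Data.Nat.Properties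
  using (≤-refl; ≤-trans; ≤-reflexive; ≤-<-trans; <-≤-trans; <⇒≢; <-irrefl; n≤1+n; m≤m+n;
         +-comm; *-suc; +-cancelʳ-≡; +-mono-≤; +-mono-<-≤; +-mono-≤-<; *-monoˡ-≤)
open import Data.Product as Product using (Σ; ∃; _×_; _,_; proj₁; proj₂)
open import Data.Sum as Sum using (_⊎_; inj₁; inj₂)
open import Data.Vec using (Vec; []; _∷_; lookup; tail; tabulate; replicate; updateAt)
open import Data.Vec.Properties
  using (≡-dec; tabulate-cong; tabulate∘lookup; updateAt-updateAt; updateAt-id-local;
         lookup∘updateAt; lookup∘updateAt′)
open import Function using (_∘_; mk⇔)
open import Relation.Binary.Construct.Closure.ReflexiveTransitive using (Star; ε; _◅_; _◅◅_; gmap)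
open import Relation.Binary.Definitions using (DecidableEquality)
open import Relation.Binary.PropositionalEquality as ≡
  using (_≡_; _≢_; refl; cong; cong₂; trans; subst; module ≡-Reasoning)
open import Relation.Nullary using (Dec; yes; no; does; ¬_; ¬?; contradiction)
open import Relation.Nullary.Decidable using (toSum; dec-true; dec-false; does-⇔; _×-dec_; _⊎-dec_)

does-true⁻¹ : ∀ {P : Set} (p? : Dec P) → does p? ≡ true → P
does-true⁻¹ (yes p) _ = p
does-true⁻¹ (no _) ()

does-false⁻¹ : ∀ {P : Set} (p? : Dec P) → does p? ≡ false → ¬ P
does-false⁻¹ (no ¬p) _ = ¬p
does-false⁻¹ (yes _) ()

reach-trans : ∀ {G u v w} → Reach G u v → Reach G v w → Reach G u w
reach-trans here q = q
reach-trans (step a p) q = step a (reach-trans p q)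

-- Cycles

[m+n%d]%d≡[m+n]%d : ∀ m n d .{{_ : NonZero d}} → (m + n % d) % d ≡ (m + n) % d
[m+n%d]%d≡[m+n]%d m n d = begin
  (m + n % d) % d            ≡⟨ %-distribˡ-+ m (n % d) d ⟩
  (m % d + n % d % d) % d    ≡⟨ cong (λ r → (m % d + r) % d) (m%n%n≡m%n n d) ⟩
  (m % d + n % d) % d        ≡⟨ %-distribˡ-+ m n d ⟨
  (m + n) % d                ∎
  where open ≡-Reasoning

[k+r]%n≢r : ∀ {k} r n .{{_ : NonZero n}} → 0 < k → k < n → (k + r) % n ≢ r
[k+r]%n≢r {k} r n 0<k k<n eq = no-multiple ((k + r) / n) k≡q*n
  where
  k≡q*n : k ≡ (k + r) / n * n
  k≡q*n = +-cancelʳ-≡ r k _ (begin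
    k + r                          ≡⟨ m≡m%n+[m/n]*n (k + r) n ⟩
    (k + r) % n + (k + r) / n * n  ≡⟨ cong (_+ (k + r) / n * n) eq ⟩
    r + (k + r) / n * n            ≡⟨ +-comm r _ ⟩
    (k + r) / n * n + r            ∎)
    where open ≡-Reasoning
  no-multiple : ∀ q → k ≢ q * n
  no-multiple zero k≡0 = <⇒≢ 0<k (≡.sym k≡0)
  no-multiple (suc q) k≡n+qn = <-irrefl refl (≤-<-trans (subst (n ≤_) (≡.sym k≡n+qn) (m≤m+n n (q * n))) k<n)

[k+j]%n≢j%n : ∀ {k} j n .{{_ : NonZero n}} → 0 < k → k < n → (k + j) % n ≢ j % n
[k+j]%n≢j%n {k} j n 0<k k<n eq =
  [k+r]%n≢r (j % n) n 0<k k<n (trans ([m+n%d]%d≡[m+n]%d k j n) eq)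

module CycleWalk (m : ℕ) where

  walk : ℕ → Fin (suc m)
  walk j = fromℕ< (m%n<n j (suc m))

  toℕ-walk : ∀ j → toℕ (walk j) ≡ j % suc m
  toℕ-walk j = toℕ-fromℕ< (m%n<n j (suc m))

  walk-periodic : ∀ j → walk (j + suc m) ≡ walk j
  walk-periodic j = toℕ-injective (begin
    toℕ (walk (j + suc m))  ≡⟨ toℕ-walk (j + suc m) ⟩
    (j + suc m) % suc m     ≡⟨ [m+n]%n≡m%n j (suc m) ⟩
    j % suc m               ≡⟨ toℕ-walk j ⟨
    toℕ (walk j)            ∎)
    where open ≡-Reasoning

  walk-shift-≢ : ∀ {k} j → 0 < k → k ≤ m → walk (k + j) ≢ walk j
  walk-shift-≢ {k} j 0<k k≤m eq =
    [k+j]%n≢j%n j (suc m) 0<k (s≤s k≤m)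
      (trans (≡.sym (toℕ-walk (k + j))) (trans (cong toℕ eq) (toℕ-walk j)))

  toℕ-walk-suc : ∀ j → toℕ (walk (suc j)) ≡ suc (toℕ (walk j)) % suc m
  toℕ-walk-suc j = begin
    toℕ (walk (suc j))           ≡⟨ toℕ-walk (suc j) ⟩
    suc j % suc m                ≡⟨ [m+n%d]%d≡[m+n]%d 1 j (suc m) ⟨
    suc (j % suc m) % suc m      ≡⟨ cong (λ r → suc r % suc m) (toℕ-walk j) ⟨
    suc (toℕ (walk j)) % suc m   ∎
    where open ≡-Reasoning

  cycAdj-walk : ∀ j → cycAdj m (walk j) (walk (suc j)) ≡ true
  cycAdj-walk j = cong (_∨ (toℕ (walk j) ℕ.≡ᵇ suc (toℕ (walk (suc j))) % suc m))
    (dec-true (_ ℕ.≟ _) (toℕ-walk-suc j))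

  cycAdj-walk-skip : 3 ≤ m → ∀ j → cycAdj m (walk j) (walk (2 + j)) ≡ false
  cycAdj-walk-skip 3≤m j = cong₂ _∨_
    (dec-false (_ ℕ.≟ _) λ eq → walk-shift-≢ (suc j) (s≤s z≤n) (≤-trans (s≤s z≤n) 3≤m)
      (toℕ-injective (trans eq (≡.sym (toℕ-walk-suc j)))))
    (dec-false (_ ℕ.≟ _) λ eq → walk-shift-≢ j (s≤s z≤n) 3≤m
      (toℕ-injective (≡.sym (trans eq (≡.sym (toℕ-walk-suc (2 + j)))))))

alternating-has-no-odd-period : (s : ℕ → Bool) → (∀ j → s (suc j) ≡ not (s j)) →
  ∀ t → s (1 + 2 * t) ≢ s 0
alternating-has-no-odd-period s alternates t period =
  not-¬ (≡.sym (even t)) (trans (≡.sym period) (alternates (2 * t)))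
  where
  even : ∀ t → s (2 * t) ≡ s 0
  even zero = refl
  even (suc t) = begin
    s (2 * suc t)          ≡⟨ cong s (*-suc 2 t) ⟩
    s (2 + 2 * t)          ≡⟨ alternates (1 + 2 * t) ⟩
    not (s (1 + 2 * t))    ≡⟨ cong not (alternates (2 * t)) ⟩
    not (not (s (2 * t)))  ≡⟨ not-involutive _ ⟩
    s (2 * t)              ≡⟨ even t ⟩
    s 0                    ∎
    where open ≡-Reasoning

-- Line graphs of bipartite graphs

module LineGraph {N : ℕ} {A B : Set} (_≟ᴬ_ : DecidableEquality A) (_≟ᴮ_ : DecidableEquality B)
                 (left : Fin N → A) (right : Fin N → B) where

  Shares : Fin N → Fin N → Set
  Shares u v = left u ≡ left v ⊎ right u ≡ right v

  shares-sym : ∀ {u v} → Shares u v → Shares v u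
  shares-sym = Sum.map ≡.sym ≡.sym

  LineAdj : Fin N → Fin N → Set
  LineAdj u v = u ≢ v × Shares u v

  lineAdj? : ∀ u v → Dec (LineAdj u v)
  lineAdj? u v = ¬? (u Fin.≟ v) ×-dec (left u ≟ᴬ left v ⊎-dec right u ≟ᴮ right v)

  lineGraph : Graph
  lineGraph = record
    { n      = N
    ; adj    = λ u v → does (lineAdj? u v)
    ; sym    = λ u v → does-⇔ (mk⇔ swap swap) (lineAdj? u v) (lineAdj? v u)
    ; irrefl = λ v → dec-false (lineAdj? v v) λ (v≢v , _) → v≢v refl
    }
    where
    swap : ∀ {u v} → LineAdj u v → LineAdj v u
    swap (u≢v , shares) = u≢v ∘ ≡.sym , shares-sym shares

  adj⇒shares : ∀ {u v} → Adj lineGraph u v → Shares u v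
  adj⇒shares {u} {v} = proj₂ ∘ does-true⁻¹ (lineAdj? u v)

  nonAdj⇒¬shares : ∀ {u v} → u ≢ v → NonAdj lineGraph u v → ¬ Shares u v
  nonAdj⇒¬shares {u} {v} u≢v nonAdj shares = does-false⁻¹ (lineAdj? u v) nonAdj (u≢v , shares)

  shares⇒stepOrStay : ∀ {u v} → Shares u v → StepOrStay lineGraph u v
  shares⇒stepOrStay {u} {v} shares =
    Sum.map₂ (λ u≢v → dec-true (lineAdj? u v) (u≢v , shares)) (toSum (u Fin.≟ v))

  shares⇒reach : ∀ {u v w} → Shares u v → Reach lineGraph v w → Reach lineGraph u w
  shares⇒reach shares reach with shares⇒stepOrStay shares
  ... | inj₁ refl = reach
  ... | inj₂ adj  = step adj reach

  clawFree : ClawFree lineGraph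
  clawFree (c , a , b , d , ca , cb , cd , a≢b , a≢d , b≢d , ab , ad , bd) =
    pigeonhole (adj⇒shares ca) (adj⇒shares cb) (adj⇒shares cd)
    where
    pigeonhole : Shares c a → Shares c b → Shares c d → ⊥
    pigeonhole (inj₁ p) (inj₁ q) _        = nonAdj⇒¬shares a≢b ab (inj₁ (trans (≡.sym p) q))
    pigeonhole (inj₂ p) (inj₂ q) _        = nonAdj⇒¬shares a≢b ab (inj₂ (trans (≡.sym p) q))
    pigeonhole (inj₁ p) _        (inj₁ q) = nonAdj⇒¬shares a≢d ad (inj₁ (trans (≡.sym p) q))
    pigeonhole (inj₂ p) _        (inj₂ q) = nonAdj⇒¬shares a≢d ad (inj₂ (trans (≡.sym p) q))
    pigeonhole _        (inj₁ p) (inj₁ q) = nonAdj⇒¬shares b≢d bd (inj₁ (trans (≡.sym p) q))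
    pigeonhole _        (inj₂ p) (inj₂ q) = nonAdj⇒¬shares b≢d bd (inj₂ (trans (≡.sym p) q))

  sharesLeft : Fin N → Fin N → Bool
  sharesLeft u v = does (left u ≟ᴬ left v)

  induced-path-alternates : ∀ {u v w} → Adj lineGraph u v → Adj lineGraph v w →
    u ≢ w → NonAdj lineGraph u w → sharesLeft v w ≡ not (sharesLeft u v)
  induced-path-alternates {u} {v} {w} uv vw u≢w uw
    with left u ≟ᴬ left v | left v ≟ᴬ left w | adj⇒shares uv | adj⇒shares vw
  ... | yes p | yes q | _        | _        = ⊥-elim (nonAdj⇒¬shares u≢w uw (inj₁ (trans p q)))
  ... | yes _ | no _  | _        | _        = refl
  ... | no _  | yes _ | _        | _        = refl
  ... | no ¬p | no ¬q | inj₁ p   | _        = ⊥-elim (¬p p)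
  ... | no ¬p | no ¬q | inj₂ _   | inj₁ q   = ⊥-elim (¬q q)
  ... | no ¬p | no ¬q | inj₂ p   | inj₂ q   = ⊥-elim (nonAdj⇒¬shares u≢w uw (inj₂ (trans p q)))

  oddHoleFree : OddHoleFree lineGraph
  oddHoleFree (m , s≤s 3≤m , (t , length≡1+2t) , f , f-injective , f-induces) =
    alternating-has-no-odd-period side side-alternates t
      (subst (λ l → side l ≡ side 0) length≡1+2t
        (cong₂ (λ x y → sharesLeft (f x) (f y)) (walk-periodic 0) (walk-periodic 1)))
    where
    open CycleWalk m
    side : ℕ → Bool
    side j = sharesLeft (f (walk j)) (f (walk (suc j)))
    edge : ∀ j → Adj lineGraph (f (walk j)) (f (walk (suc j)))
    edge j = trans (f-induces _ _) (cycAdj-walk j)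
    side-alternates : ∀ j → side (suc j) ≡ not (side j)
    side-alternates j = induced-path-alternates (edge j) (edge (suc j))
      (λ eq → walk-shift-≢ j (s≤s z≤n) (≤-trans (s≤s (s≤s z≤n)) 3≤m) (≡.sym (f-injective eq)))
      (trans (f-induces _ _) (cycAdj-walk-skip 3≤m j))

-- Hamming distance

toggle : ∀ {D} → Fin D → Vec Bool D → Vec Bool D
toggle i a = updateAt a i not

toggle-involutive : ∀ {D} (i : Fin D) a → toggle i (toggle i a) ≡ a
toggle-involutive i a = trans (updateAt-updateAt i a) (updateAt-id-local i a (not-involutive _))

hamming : ∀ {D} → Vec Bool D → Vec Bool D → ℕ
hamming []      []      = 0
hamming (x ∷ a) (y ∷ b) = if does (x Bool.≟ y) then hamming a b else suc (hamming a b)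

hamming-self : ∀ {D} (a : Vec Bool D) → hamming a a ≡ 0
hamming-self []      = refl
hamming-self (x ∷ a) with x Bool.≟ x
... | yes _  = hamming-self a
... | no x≢x = contradiction refl x≢x

hamming-∷-≥ : ∀ {D} x y (a b : Vec Bool D) → hamming a b ≤ hamming (x ∷ a) (y ∷ b)
hamming-∷-≥ x y a b with x Bool.≟ y
... | yes _ = ≤-refl
... | no _  = n≤1+n _

hamming-∷-≤ : ∀ {D} x y (a b : Vec Bool D) → hamming (x ∷ a) (y ∷ b) ≤ suc (hamming a b)
hamming-∷-≤ x y a b with x Bool.≟ y
... | yes _ = n≤1+n _
... | no _  = ≤-refl

hamming-∷-≢ : ∀ {D} {x y} (a b : Vec Bool D) → x ≢ y → hamming (x ∷ a) (y ∷ b) ≡ suc (hamming a b)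
hamming-∷-≢ {x = x} {y} a b x≢y with x Bool.≟ y
... | yes x≡y = contradiction x≡y x≢y
... | no _    = refl

hamming-toggle : ∀ {D} (i : Fin D) a b → hamming a (toggle i b) ≤ suc (hamming a b)
hamming-toggle zero    (x ∷ a) (y ∷ b) = ≤-trans (hamming-∷-≤ x (not y) a b) (s≤s (hamming-∷-≥ x y a b))
hamming-toggle (suc i) (x ∷ a) (y ∷ b) with x Bool.≟ y
... | yes _ = hamming-toggle i a b
... | no _  = s≤s (hamming-toggle i a b)

hamming-toggle-self : ∀ {D} (i : Fin D) a → hamming a (toggle i a) ≤ 1
hamming-toggle-self i a = subst (λ d → hamming a (toggle i a) ≤ suc d) (hamming-self a) (hamming-toggle i a a)

lookup-toggle-≢ : ∀ {D} (i : Fin D) a → lookup (toggle i a) i ≢ lookup a i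
lookup-toggle-≢ i a eq = not-¬ refl (≡.sym (trans (≡.sym (lookup∘updateAt i a)) eq))

sum-map-mono-≤ : ∀ {A : Set} {f g : A → ℕ} → (∀ x → f x ≤ g x) →
  ∀ xs → sum (map f xs) ≤ sum (map g xs)
sum-map-mono-≤ f≤g []       = z≤n
sum-map-mono-≤ f≤g (x ∷ xs) = +-mono-≤ (f≤g x) (sum-map-mono-≤ f≤g xs)

sum-map-mono-< : ∀ {A : Set} {f g : A → ℕ} {xs} → (∀ x → f x ≤ g x) →
  Any (λ x → f x < g x) xs → sum (map f xs) < sum (map g xs)
sum-map-mono-< {xs = x ∷ xs} f≤g (here fx<gx) = +-mono-<-≤ fx<gx (sum-map-mono-≤ f≤g xs)
sum-map-mono-< {xs = x ∷ xs} f≤g (there any)  = +-mono-≤-< (f≤g x) (sum-map-mono-< f≤g any)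

sum-map-≤ : ∀ {A : Set} {f : A → ℕ} {c xs} → All (λ x → f x ≤ c) xs → sum (map f xs) ≤ length xs * c
sum-map-≤ []           = z≤n
sum-map-≤ (fx≤c ∷ all) = +-mono-≤ fx≤c (sum-map-≤ all)

agreeing-coordinate : ∀ {D} (a : Vec Bool D) (ys : List (Vec Bool D)) →
  sum (map (hamming a) ys) < D → ∃ λ i → All (λ y → lookup y i ≡ lookup a i) ys
agreeing-coordinate {zero}  _       _  ()
agreeing-coordinate {suc D} (x ∷ a) ys total<D with All.all? (λ y → lookup y zero Bool.≟ x) ys
... | yes heads-agree = zero , heads-agree
... | no heads-disagree = shift (agreeing-coordinate a (map tail ys) (<-≤-trans tails-smaller (ℕ.s≤s⁻¹ total<D)))
  where
  lookup-suc : ∀ (y : Vec Bool (suc D)) i → lookup (tail y) i ≡ lookup a i → lookup y (suc i) ≡ lookup a i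
  lookup-suc (_ ∷ _) _ agree = agree
  shift : (∃ λ i → All (λ t → lookup t i ≡ lookup a i) (map tail ys)) →
          ∃ λ i → All (λ y → lookup y i ≡ lookup (x ∷ a) i) ys
  shift (i , tails-agree) = suc i , All.map (λ {y} → lookup-suc y i) (map⁻ tails-agree)
  tail-≤ : ∀ y → hamming a (tail y) ≤ hamming (x ∷ a) y
  tail-≤ (h ∷ t) = hamming-∷-≥ x h a t
  tail-< : ∀ {y} → lookup y zero ≢ x → hamming a (tail y) < hamming (x ∷ a) y
  tail-< {h ∷ t} h≢x = ≤-reflexive (≡.sym (hamming-∷-≢ a t (h≢x ∘ ≡.sym)))
  tails-smaller : sum (map (hamming a) (map tail ys)) < sum (map (hamming (x ∷ a)) ys)
  tails-smaller = subst (_< sum (map (hamming (x ∷ a)) ys)) (cong sum (map-∘ ys))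
    (sum-map-mono-< tail-≤
      (Any.map (λ {y} → tail-< {y}) (¬All⇒Any¬ (λ y → lookup y zero Bool.≟ x) ys heads-disagree)))

-- The graph H_D and its line graph

-- A vertex (σ , a) of H_D lies on side σ; the edge (a , s) joins (false , a) to (true , a ⊕ s),
-- where ⊕ zero is the identity and ⊕ suc i toggles coordinate i.
Vertex : ℕ → Set
Vertex D = Bool × Vec Bool D

Edge : ℕ → Set
Edge D = Vec Bool D × Fin (suc D)

_⊕_ : ∀ {D} → Vec Bool D → Fin (suc D) → Vec Bool D
a ⊕ zero  = a
a ⊕ suc i = toggle i a

⊕-involutive : ∀ {D} (a : Vec Bool D) s → (a ⊕ s) ⊕ s ≡ a
⊕-involutive a zero    = refl
⊕-involutive a (suc i) = toggle-involutive i a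

tip : ∀ {D} → Edge D → Vec Bool D
tip (a , s) = a ⊕ s

Incident : ∀ {D} → Vertex D → Edge D → Set
Incident x e = x ≡ (false , proj₁ e) ⊎ x ≡ (true , tip e)

_∈N[_] : ∀ {D} → Vertex D → Vertex D → Set
x ∈N[ w ] = x ≡ w ⊎ (proj₁ x ≡ not (proj₁ w) × ∃ λ s → proj₂ x ≡ proj₂ w ⊕ s)

incident-near : ∀ {D} {x y : Vertex D} {e} → Incident x e → Incident y e → y ∈N[ x ]
incident-near (inj₁ refl) (inj₁ refl) = inj₁ refl
incident-near (inj₂ refl) (inj₂ refl) = inj₁ refl
incident-near {e = a , s} (inj₁ refl) (inj₂ refl) = inj₂ (refl , s , refl)
incident-near {e = a , s} (inj₂ refl) (inj₁ refl) = inj₂ (refl , s , ≡.sym (⊕-involutive a s))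

neighbour : ∀ {D} → Vertex D → Fin D → Vertex D
neighbour (σ , a) i = not σ , toggle i a

neighbour-≢ : ∀ {D} (u : Vertex D) i → neighbour u i ≢ u
neighbour-≢ (σ , a) i eq = not-¬ refl (≡.sym (cong proj₁ eq))

edgeToward : ∀ {D} → Vertex D → Fin D → Edge D
edgeToward (false , a) i = a , suc i
edgeToward (true  , b) i = toggle i b , suc i

edgeToward-incident : ∀ {D} (u : Vertex D) i → Incident u (edgeToward u i)
edgeToward-incident (false , a) i = inj₁ refl
edgeToward-incident (true  , b) i = inj₂ (cong (true ,_) (≡.sym (toggle-involutive i b)))

edgeToward-incident-neighbour : ∀ {D} (u : Vertex D) i → Incident (neighbour u i) (edgeToward u i)
edgeToward-incident-neighbour (false , a) i = inj₂ refl
edgeToward-incident-neighbour (true  , b) i = inj₁ refl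

near-neighbour-close : ∀ {D} (u : Vertex D) i {x} → x ∈N[ neighbour u i ] → hamming (proj₂ u) (proj₂ x) ≤ 2
near-neighbour-close (σ , a) i (inj₁ refl)               = ≤-trans (hamming-toggle-self i a) (s≤s z≤n)
near-neighbour-close (σ , a) i (inj₂ (_ , zero  , refl)) = ≤-trans (hamming-toggle-self i a) (s≤s z≤n)
near-neighbour-close (σ , a) i (inj₂ (_ , suc j , refl)) =
  ≤-trans (hamming-toggle j a (toggle i a)) (s≤s (hamming-toggle-self i a))

near-neighbour-agree : ∀ {D} (u : Vertex D) i {x} → x ∈N[ neighbour u i ] →
  lookup (proj₂ x) i ≡ lookup (proj₂ u) i → x ≡ u
near-neighbour-agree (σ , a) i (inj₁ refl)               agree = ⊥-elim (lookup-toggle-≢ i a agree)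
near-neighbour-agree (σ , a) i (inj₂ (_ , zero  , refl)) agree = ⊥-elim (lookup-toggle-≢ i a agree)
near-neighbour-agree (σ , a) i (inj₂ (τ≡ , suc j , refl)) agree with j Fin.≟ i
... | yes refl = cong₂ _,_ (trans τ≡ (not-involutive σ)) (toggle-involutive i a)
... | no j≢i   =
  ⊥-elim (lookup-toggle-≢ i a (trans (≡.sym (lookup∘updateAt′ i j (j≢i ∘ ≡.sym) (toggle i a))) agree))

escape : ∀ {D} (u : Vertex D) (X : List (Vertex D)) → length X * 2 < D →
  ∃ λ i → ∀ {x} → x ∈ X → x ∈N[ neighbour u i ] → x ≡ u
escape {D} u X room = Product.map₂ clear (agreeing-coordinate (proj₂ u) ys bound)
  where
  close? : ∀ x → Dec (hamming (proj₂ u) (proj₂ x) ≤ 2)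
  close? x = hamming (proj₂ u) (proj₂ x) ≤? 2
  ys : List (Vec Bool D)
  ys = map proj₂ (filter close? X)
  length-ys : length ys ≤ length X
  length-ys = subst (_≤ length X) (≡.sym (length-map proj₂ (filter close? X))) (length-filter close? X)
  bound : sum (map (hamming (proj₂ u)) ys) < D
  bound = ≤-<-trans (≤-trans (sum-map-≤ (map⁺ (all-filter close? X))) (*-monoˡ-≤ 2 length-ys)) room
  clear : ∀ {i} → All (λ y → lookup y i ≡ lookup (proj₂ u) i) ys →
          ∀ {x} → x ∈ X → x ∈N[ neighbour u i ] → x ≡ u
  clear agree x∈X near = near-neighbour-agree u _ near
    (All.lookup agree (∈-map⁺ proj₂ (∈-filter⁺ close? x∈X (near-neighbour-close u _ near))))

toBool : Fin 2 → Bool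
toBool zero    = false
toBool (suc _) = true

fromBool : Bool → Fin 2
fromBool false = zero
fromBool true  = suc zero

toBool-fromBool : ∀ b → toBool (fromBool b) ≡ b
toBool-fromBool false = refl
toBool-fromBool true  = refl

vecOf : ∀ {D} → Fin (2 ^ D) → Vec Bool D
vecOf p = tabulate (toBool ∘ finToFun p)

codeOf : ∀ {D} → Vec Bool D → Fin (2 ^ D)
codeOf a = funToFin (fromBool ∘ lookup a)

vecOf-codeOf : ∀ {D} (a : Vec Bool D) → vecOf (codeOf a) ≡ a
vecOf-codeOf a = trans
  (tabulate-cong λ i → trans (cong toBool (finToFun-funToFin (fromBool ∘ lookup a) i)) (toBool-fromBool (lookup a i)))
  (tabulate∘lookup a)

edgeCount : ℕ → ℕ
edgeCount D = 2 ^ D * suc D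

edgeAt : ∀ {D} → Fin (edgeCount D) → Edge D
edgeAt {D} e = Product.map₁ vecOf (remQuot (suc D) e)

indexOf : ∀ {D} → Edge D → Fin (edgeCount D)
indexOf (a , s) = combine (codeOf a) s

edgeAt-indexOf : ∀ {D} (e : Edge D) → edgeAt (indexOf e) ≡ e
edgeAt-indexOf {D} (a , s) = trans (cong (Product.map₁ vecOf) (remQuot-combine (codeOf a) s))
  (cong (_, s) (vecOf-codeOf a))

module LineH (D : ℕ) = LineGraph (≡-dec Bool._≟_) (≡-dec Bool._≟_) (proj₁ ∘ edgeAt {D}) (tip ∘ edgeAt {D})

Toggle : ∀ {D} → Vec Bool D → Vec Bool D → Set
Toggle a b = ∃ λ i → toggle i a ≡ b

hypercube-connected : ∀ {D} (a b : Vec Bool D) → Star Toggle a b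
hypercube-connected []      []      = ε
hypercube-connected (x ∷ a) (y ∷ b) =
  gmap (x ∷_) (Product.map suc (cong (x ∷_))) (hypercube-connected a b) ◅◅ last x y
  where
  last : ∀ x y → Star Toggle (x ∷ b) (y ∷ b)
  last false false = ε
  last true  true  = ε
  last false true  = (zero , refl) ◅ ε
  last true  false = (zero , refl) ◅ ε

module _ {D : ℕ} where
  open LineH D

  incident-indexOf : ∀ {x} e → Incident x e → Incident x (edgeAt {D} (indexOf e))
  incident-indexOf {x} e = subst (Incident x) (≡.sym (edgeAt-indexOf e))

  shares⇒common-end : ∀ {u v} → Shares u v → ∃ λ x → Incident x (edgeAt {D} u) × Incident x (edgeAt {D} v)
  shares⇒common-end (inj₁ eq) = _ , inj₁ refl , inj₁ (cong (false ,_) eq)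
  shares⇒common-end (inj₂ eq) = _ , inj₂ refl , inj₂ (cong (true ,_) eq)

  common-end⇒shares : ∀ {u v x} → Incident x (edgeAt {D} u) → Incident x (edgeAt {D} v) → Shares u v
  common-end⇒shares (inj₁ refl) (inj₁ eq) = inj₁ (cong proj₂ eq)
  common-end⇒shares (inj₂ refl) (inj₂ eq) = inj₂ (cong proj₂ eq)
  common-end⇒shares (inj₁ refl) (inj₂ ())
  common-end⇒shares (inj₂ refl) (inj₁ ())

  base : Vec Bool D → Fin (edgeCount D)
  base a = indexOf (a , zero)

  shares-base : ∀ u → Shares (base (proj₁ (edgeAt {D} u))) u
  shares-base u = common-end⇒shares (incident-indexOf (proj₁ (edgeAt {D} u) , zero) (inj₁ refl)) (inj₁ refl)

  reach-toggle : ∀ {a b} → Toggle a b → Reach lineGraph (base a) (base b)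
  reach-toggle {a} (i , refl) =
    shares⇒reach (common-end⇒shares (incident-indexOf (a , zero) (inj₁ refl)) (incident-indexOf via (inj₁ refl)))
      (shares⇒reach
        (common-end⇒shares (incident-indexOf via (inj₂ refl)) (incident-indexOf (toggle i a , zero) (inj₂ refl)))
        here)
    where
    via : Edge D
    via = a , suc i

  reach-base : ∀ {a b} → Star Toggle a b → Reach lineGraph (base a) (base b)
  reach-base ε          = here
  reach-base (t ◅ path) = reach-trans (reach-toggle t) (reach-base path)

  connected : Connected lineGraph
  connected = ≤-<-trans z≤n (toℕ<n (base (replicate D false))) , λ u v →
    shares⇒reach (shares-sym (shares-base u))
      (reach-trans (reach-base (hypercube-connected (proj₁ (edgeAt {D} u)) (proj₁ (edgeAt {D} v))))
        (shares⇒reach (shares-base v) here))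

  Safe : ∀ {k} → Config lineGraph k → Vertex D → Set
  Safe cs u = ∀ j {x} → Incident x (edgeAt {D} (cs j)) → ¬ x ∈N[ u ]

  Untouched : ∀ {k} → Config lineGraph k → Vertex D → Set
  Untouched cs u = ∀ j → ¬ Incident u (edgeAt {D} (cs j))

  Clear : ∀ {k} → Config lineGraph k → Vertex D → Fin D → Set
  Clear cs u i = ∀ j {x} → Incident x (edgeAt {D} (cs j)) → x ∈N[ neighbour u i ] → x ≡ u

  SafeEdge : ∀ {k} → Config lineGraph k → Fin (edgeCount D) → Set
  SafeEdge cs r = ∃ λ u → Safe cs u × Incident u (edgeAt {D} r)

  endpoints : ∀ {k} → Config lineGraph k → List (Vertex D)
  endpoints {zero}  cs = []
  endpoints {suc k} cs =
    (false , proj₁ (edgeAt {D} (cs zero))) ∷ (true , tip (edgeAt {D} (cs zero))) ∷ endpoints (cs ∘ suc)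

  length-endpoints : ∀ {k} (cs : Config lineGraph k) → length (endpoints cs) ≡ k * 2
  length-endpoints {zero}  cs = refl
  length-endpoints {suc k} cs = cong (2 +_) (length-endpoints (cs ∘ suc))

  incident⇒∈endpoints : ∀ {k} (cs : Config lineGraph k) j {x} →
    Incident x (edgeAt {D} (cs j)) → x ∈ endpoints cs
  incident⇒∈endpoints cs zero    (inj₁ refl) = here refl
  incident⇒∈endpoints cs zero    (inj₂ refl) = there (here refl)
  incident⇒∈endpoints cs (suc j) incident    = there (there (incident⇒∈endpoints (cs ∘ suc) j incident))

  untouched⇒¬captured : ∀ {k} {cs : Config lineGraph k} {u r} →
    Untouched cs u → Incident u (edgeAt {D} r) → ¬ Captured lineGraph cs r
  untouched⇒¬captured untouched u∈r (j , refl) = untouched j u∈r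

  safe⇒untouched : ∀ {k} {cs : Config lineGraph k} {u} → Safe cs u → Untouched cs u
  safe⇒untouched safe j u∈cs = safe j u∈cs (inj₁ refl)

  safeEdge⇒¬captured : ∀ {k} {cs : Config lineGraph k} {r} → SafeEdge cs r → ¬ Captured lineGraph cs r
  safeEdge⇒¬captured (u , safe , u∈r) = untouched⇒¬captured (safe⇒untouched safe) u∈r

  -- A cop's new edge shares an end with its old one, and both ends of an edge are adjacent in H.
  safe⇒untouched-after-move : ∀ {k} {cs} {cs' : Config lineGraph k} {u} →
    Safe cs u → CopMove lineGraph cs cs' → Untouched cs' u
  safe⇒untouched-after-move {cs' = cs'} {u} safe move j u∈cs' with move j
  ... | inj₁ stays = safe⇒untouched safe j (subst (Incident u ∘ edgeAt {D}) (≡.sym stays) u∈cs')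
  ... | inj₂ adj with shares⇒common-end (adj⇒shares adj)
  ...   | x , x∈cs , x∈cs' = safe j x∈cs (incident-near {e = edgeAt {D} (cs' j)} u∈cs' x∈cs')

  clear⇒safe : ∀ {k} {cs : Config lineGraph k} {u i} → Clear cs u i → Untouched cs u → Safe cs (neighbour u i)
  clear⇒safe clear untouched j x∈cs near with clear j x∈cs near
  ... | refl = untouched j x∈cs

  clear⇒neighbour-untouched : ∀ {k} {cs : Config lineGraph k} {u i} →
    Clear cs u i → Untouched cs (neighbour u i)
  clear⇒neighbour-untouched {u = u} {i} clear j w∈cs = neighbour-≢ u i (clear j w∈cs (inj₁ refl))

module Pursuit {D k : ℕ} (room : k * 2 * 2 < D) where
  open LineH D

  escape-cops : (cs : Config lineGraph k) (u : Vertex D) → ∃ (Clear cs u)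
  escape-cops cs u = Product.map₂ (λ clear j x∈cs → clear (incident⇒∈endpoints cs j x∈cs))
    (escape u (endpoints cs) (subst (λ l → l * 2 < D) (≡.sym (length-endpoints cs)) room))

  robber-step : ∀ {cs cs' r} → SafeEdge cs r → CopMove lineGraph cs cs' →
    ∃ λ r' → StepOrStay lineGraph r r' × SafeEdge cs' r'
  robber-step {cs' = cs'} (u , safe , u∈r) move with escape-cops cs' u
  ... | i , clear = indexOf (edgeToward u i)
      , shares⇒stepOrStay (common-end⇒shares u∈r (incident-indexOf (edgeToward u i) (edgeToward-incident u i)))
      , neighbour u i , clear⇒safe clear (safe⇒untouched-after-move safe move)
      , incident-indexOf (edgeToward u i) (edgeToward-incident-neighbour u i)

  evade : ∀ {cs r} → SafeEdge cs r → ¬ CopsForce lineGraph k cs r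
  evade (u , safe , u∈r) (round cs' move (inj₁ captured)) =
    untouched⇒¬captured (safe⇒untouched-after-move safe move) u∈r captured
  evade safe-r (round cs' move (inj₂ respond)) with robber-step safe-r move
  ... | r' , r→r' , safe-r' with respond r' r→r'
  ...   | inj₁ captured = safeEdge⇒¬captured safe-r' captured
  ...   | inj₂ force    = evade safe-r' force

  robber-start : (cs : Config lineGraph k) → ∃ (SafeEdge cs)
  robber-start cs = from-clear (escape-cops cs u₀)
    where
    u₀ : Vertex D
    u₀ = false , replicate D false
    from-clear : ∃ (Clear cs u₀) → ∃ (SafeEdge cs)
    from-clear (i₁ , clear₁) with escape-cops cs (neighbour u₀ i₁)
    ... | i₂ , clear₂ = indexOf (edgeToward (neighbour u₀ i₁) i₂) , neighbour (neighbour u₀ i₁) i₂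
        , clear⇒safe clear₂ (clear⇒neighbour-untouched clear₁)
        , incident-indexOf (edgeToward (neighbour u₀ i₁) i₂) (edgeToward-incident-neighbour (neighbour u₀ i₁) i₂)

  cops-lose : ¬ CopsWin lineGraph k
  cops-lose (cs , catch) = escapes (robber-start cs)
    where
    escapes : ∃ (SafeEdge cs) → ⊥
    escapes (r , safe-r) with catch r
    ... | inj₁ captured = safeEdge⇒¬captured safe-r captured
    ... | inj₂ force    = evade safe-r force

corollary1p1 : (k : ℕ) → Σ Graph λ G →
    Connected G × ClawFree G × OddHoleFree G × CopNumberGreaterThan G k
corollary1p1 k = lineGraph , connected , clawFree , oddHoleFree , Pursuit.cops-lose ≤-refl
  where open LineH (suc (k * 2 * 2))
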